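{- For any graphs $G$ and $H$, $\mathrm{scw}(G\square H)\leq \min\{|V(H)|\,\mathrm{scw}(G),\ |V(G)|\,\mathrm{scw}(H)\}$.
   Context: All graphs are finite connected multigraphs (multiple edges allowed, no loops). The Cartesian product $G\square H$ has vertex set $V(G)\times V(H)$, with $(u,v)$ and $(u',v')$ joined by as many edges as $v,v'$ are joined in $H$ when $u=u'$, and as many as $u,u'$ are joined in $G$ when $v=v'$ (no other edges). Screewidth: a tree-cut decomposition of $G$ is a pair $(T,\mathcal{X})$ with $T$ a tree (vertices = nodes, edges = links) and $\mathcal{X}=\{X_b: b\in V(T)\}$ pairwise disjoint, possibly empty subsets of $V(G)$ (bags) with union $V(G)$. For a link $l$, $\mathrm{adh}(l)$ is the set of edges of $G$ with endpoints in bags $X_b,X_d$ where $b,d$ lie in different components of $T-l$; for a node $b$, $\mathrm{adh}(b)$ is the set of edges of $G$ with endpoints in bags $X_c,X_d$ where $c,d$ lie in different components of $T-b$. The width is $\max\{\max_l|\mathrm{adh}(l)|,\ \max_b(|X_b|+|\mathrm{adh}(b)|)\}$, and $\mathrm{scw}(G)$ is the minimum width over all tree-cut decompositions of $G$. -}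

module Defs where

open import Data.Nat using (ℕ; zero; suc; _+_; _*_; _∸_; _≤_; _<_; _⊓_)
open import Data.Nat.Properties using (_≟_)
open import Data.Fin using (Fin; toℕ; _<?_; remQuot)
open import Data.Fin.Properties using () renaming (_≟_ to _≟ᶠ_)
open import Data.Bool using (Bool; true; false; _∧_; _∨_; not; if_then_else_; T)
open import Data.Product using (Σ; _×_; _,_; proj₁; proj₂)
open import Data.Vec.Functional using (foldr)
open import Relation.Nullary.Decidable using (⌊_⌋)
open import Relation.Binary.PropositionalEquality using (_≡_)

Σᶠ : {n : ℕ} → (Fin n → ℕ) → ℕ
Σᶠ f = foldr _+_ 0 f

anyᶠ : {n : ℕ} → (Fin n → Bool) → Bool
anyᶠ f = foldr _∨_ false f

record Graph : Set where
  field
    n     : ℕ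
    mult  : Fin n → Fin n → ℕ

walk : {k : ℕ} → (Fin k → Fin k → Bool) → ℕ → Fin k → Fin k → Bool
walk adj zero    i j = ⌊ i ≟ᶠ j ⌋
walk adj (suc s) i j = walk adj s i j ∨ anyᶠ (λ t → walk adj s i t ∧ adj t j)

-- connected: any two vertices joined by a walk (length < number of vertices suffices)
reach : {k : ℕ} → (Fin k → Fin k → Bool) → Fin k → Fin k → Bool
reach {k} adj = walk adj k

Connected : {k : ℕ} → (Fin k → Fin k → Bool) → Set
Connected adj = ∀ i j → T (reach adj i j)

adjG : (G : Graph) → Fin (Graph.n G) → Fin (Graph.n G) → Bool
adjG G u v = not ⌊ Graph.mult G u v ≟ 0 ⌋

IsGraph : Graph → Set
IsGraph G = (∀ u v → Graph.mult G u v ≡ Graph.mult G v u)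
          × (∀ u → Graph.mult G u u ≡ 0)
          × Connected (adjG G)

edgeCount : {n : ℕ} → (Fin n → Fin n → ℕ) → (Fin n → Fin n → Bool) → ℕ
edgeCount m keep =
  Σᶠ (λ u → Σᶠ (λ v → if ⌊ u <? v ⌋ ∧ keep u v then m u v else 0))

record Tree : Set where
  field
    k     : ℕ
    nonempty : 0 < k
    link  : Fin k → Fin k → Bool
    sym   : ∀ a b → link a b ≡ link b a
    irrefl : ∀ a → link a a ≡ false
    connected : Connected link
    linkCount : edgeCount (λ a b → if link a b then 1 else 0) (λ _ _ → true) ≡ k ∸ 1

delLink : {k : ℕ} → (Fin k → Fin k → Bool) → Fin k → Fin k → (Fin k → Fin k → Bool)
delLink L a b x y =
  L x y ∧ not ((⌊ x ≟ᶠ a ⌋ ∧ ⌊ y ≟ᶠ b ⌋) ∨ (⌊ x ≟ᶠ b ⌋ ∧ ⌊ y ≟ᶠ a ⌋))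

delNode : {k : ℕ} → (Fin k → Fin k → Bool) → Fin k → (Fin k → Fin k → Bool)
delNode L b x y = L x y ∧ not (⌊ x ≟ᶠ b ⌋ ∨ ⌊ y ≟ᶠ b ⌋)

-- Tree-cut decompositions.  The bags are pairwise disjoint with union
-- V(G), i.e. every vertex lies in exactly one bag: bag : V(G) → V(T).

record TreeCutDecomposition (G : Graph) : Set where
  field
    tree : Tree
    bag  : Fin (Graph.n G) → Fin (Tree.k tree)

module _ {G : Graph} (D : TreeCutDecomposition G) where
  open Graph G
  open TreeCutDecomposition D
  open Tree tree renaming (k to K)

  adhLink : Fin K → Fin K → ℕ
  adhLink a b = edgeCount mult (λ u v → not (reach (delLink link a b) (bag u) (bag v)))

  -- |adh(b)|: edges whose endpoints' bags are distinct and not b... precisely: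
  -- endpoints in bags X_c, X_d with c, d in different components of T - b
  -- (c, d ≠ b; b itself is not a node of T - b)
  adhNode : Fin K → ℕ
  adhNode b = edgeCount mult (λ u v →
    not ⌊ bag u ≟ᶠ b ⌋ ∧ not ⌊ bag v ≟ᶠ b ⌋ ∧ not (reach (delNode link b) (bag u) (bag v)))

  bagSize : Fin K → ℕ
  bagSize b = Σᶠ (λ u → if ⌊ bag u ≟ᶠ b ⌋ then 1 else 0)

  WidthAtMost : ℕ → Set
  WidthAtMost w =
    (∀ a b → T (link a b) → adhLink a b ≤ w) × (∀ b → bagSize b + adhNode b ≤ w)

ScwAtMost : Graph → ℕ → Set
ScwAtMost G w = Σ (TreeCutDecomposition G) (λ D → WidthAtMost D w)

-- Cartesian product.  Vertex (u , v) of G □ H is encoded as the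
-- element of Fin (nG * nH) given by Data.Fin.combine u v.

_□_ : Graph → Graph → Graph
G □ H = record { n = nG * nH ; mult = m }
  where
  nG = Graph.n G
  nH = Graph.n H
  m : Fin (nG * nH) → Fin (nG * nH) → ℕ
  m x y with remQuot {nG} nH x | remQuot {nG} nH y
  ... | (u , v) | (u' , v') =
    if ⌊ u ≟ᶠ u' ⌋ then Graph.mult H v v'
    else (if ⌊ v ≟ᶠ v' ⌋ then Graph.mult G u u' else 0)

-- A tree-cut decomposition of G pulls back along the projection
-- V(G □ H) → V(G) to one of G □ H on the same tree: every bag X_b becomes
-- X_b × V(H), and an edge of G □ H crosses a link or node iff it is a copy,
-- in one of the |V(H)| layers G × {v}, of an edge of G crossing it (edges
-- inside a copy of H join vertices of the same bag).  So every bag size and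
-- adhesion is multiplied by exactly |V(H)|; symmetrically for H.
module Submission where

open import Defs
open import Data.Nat using (ℕ; zero; suc; _+_; _*_; _⊓_; _≤_; _<_)
open import Data.Nat.Properties
  using (+-assoc; +-identityʳ; *-distribˡ-+; *-monoʳ-≤; *-cancelˡ-<; +-cancelˡ-<;
         +-cancelʳ-<; +-monoʳ-<; ⊓-sel; +-*-semiring)
open import Data.Fin using (Fin; toℕ; _<?_; remQuot; combine; _↑ˡ_; _↑ʳ_)
  renaming (zero to fzero; suc to fsuc)
open import Data.Fin.Properties using (remQuot-combine; toℕ-combine; combine-monoˡ-<)
  renaming (_≟_ to _≟ᶠ_)
open import Data.Bool using (Bool; true; false; _∧_; not; if_then_else_)
open import Data.Bool.Properties using (∧-zeroʳ; if-eta)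
open import Data.Product using (_×_; _,_; proj₁; proj₂)
open import Data.Sum using (inj₁; inj₂)
open import Function using (_∘_; _⇔_; mk⇔)
open import Relation.Nullary.Decidable using (Dec; yes; no; ⌊_⌋; does-⇔; isYes≗does; dec-true; ⌊⌋-map′)
open import Relation.Binary.PropositionalEquality
open ≡-Reasoning

open import Algebra.Properties.Semiring.Sum +-*-semiring
  using (sum-cong-≗; sum-replicate-zero; ∑-comm; *-distribˡ-sum)

Σᶠ-const : ∀ {n} c → Σᶠ {n} (λ _ → c) ≡ n * c
Σᶠ-const {zero}  c = refl
Σᶠ-const {suc n} c = cong (c +_) (Σᶠ-const {n} c)

Σᶠ-delta : ∀ {n} (i : Fin n) (a : Fin n → ℕ) →
  Σᶠ (λ j → if ⌊ i ≟ᶠ j ⌋ then a j else 0) ≡ a i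
Σᶠ-delta {suc n} fzero    a = trans (cong (a fzero +_) (sum-replicate-zero n)) (+-identityʳ (a fzero))
Σᶠ-delta {suc n} (fsuc i) a = trans
  (sum-cong-≗ λ j → cong (λ b → if b then a (fsuc j) else 0) (⌊⌋-map′ _ _ (i ≟ᶠ j)))
  (Σᶠ-delta i (a ∘ fsuc))

Σᶠ-++ : ∀ m n (f : Fin (m + n) → ℕ) →
  Σᶠ f ≡ Σᶠ (λ i → f (i ↑ˡ n)) + Σᶠ (λ j → f (m ↑ʳ j))
Σᶠ-++ zero    n f = refl
Σᶠ-++ (suc m) n f =
  trans (cong (f fzero +_) (Σᶠ-++ m n (f ∘ fsuc))) (sym (+-assoc (f fzero) _ _))

Σᶠ-combine : ∀ m n (f : Fin (m * n) → ℕ) →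
  Σᶠ f ≡ Σᶠ {m} (λ i → Σᶠ {n} (λ j → f (combine i j)))
Σᶠ-combine zero    n f = refl
Σᶠ-combine (suc m) n f =
  trans (Σᶠ-++ n (m * n) f) (cong (Σᶠ (λ j → f (j ↑ˡ (m * n))) +_) (Σᶠ-combine m n (f ∘ (n ↑ʳ_))))

Σᶠ²-combine : ∀ m n {F : Fin (m * n) → Fin (m * n) → ℕ} {K : Fin m → Fin n → Fin m → Fin n → ℕ} →
  (∀ u v u′ v′ → F (combine u v) (combine u′ v′) ≡ K u v u′ v′) →
  Σᶠ (λ x → Σᶠ (F x)) ≡ Σᶠ {m} (λ u → Σᶠ {n} (λ v → Σᶠ {m} (λ u′ → Σᶠ {n} (K u v u′))))
Σᶠ²-combine m n {F} F≡K = trans (Σᶠ-combine m n _)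
  (sum-cong-≗ {m} λ u → sum-cong-≗ {n} λ v → trans (Σᶠ-combine m n (F (combine u v)))
    (sum-cong-≗ {m} λ u′ → sum-cong-≗ {n} (F≡K u v u′)))

⌊⌋-⇔ : ∀ {a b} {A : Set a} {B : Set b} → A ⇔ B → (a? : Dec A) (b? : Dec B) → ⌊ a? ⌋ ≡ ⌊ b? ⌋
⌊⌋-⇔ A⇔B a? b? = trans (isYes≗does a?) (trans (does-⇔ A⇔B a? b?) (sym (isYes≗does b?)))

walk-refl : ∀ {k} (adj : Fin k → Fin k → Bool) s (c : Fin k) → walk adj s c c ≡ true
walk-refl adj zero    c = trans (isYes≗does (c ≟ᶠ c)) (dec-true (c ≟ᶠ c) refl)
walk-refl adj (suc s) c rewrite walk-refl adj s c = refl

reach-refl : ∀ {k} (adj : Fin k → Fin k → Bool) (c : Fin k) → reach adj c c ≡ true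
reach-refl {k} adj = walk-refl adj k

combine-<-fst : ∀ {m n} (u u′ : Fin m) (v : Fin n) →
  ⌊ combine u v <? combine u′ v ⌋ ≡ ⌊ u <? u′ ⌋
combine-<-fst {m} {n} u u′ v = ⌊⌋-⇔ (mk⇔ cancel (combine-monoˡ-< v v)) _ _
  where
  cancel : toℕ (combine u v) < toℕ (combine u′ v) → toℕ u < toℕ u′
  cancel lt rewrite toℕ-combine u v | toℕ-combine u′ v =
    *-cancelˡ-< n (toℕ u) (toℕ u′) (+-cancelʳ-< (toℕ v) (n * toℕ u) (n * toℕ u′) lt)

combine-<-snd : ∀ {m n} (u : Fin m) (v v′ : Fin n) →
  ⌊ combine u v <? combine u v′ ⌋ ≡ ⌊ v <? v′ ⌋
combine-<-snd {m} {n} u v v′ = ⌊⌋-⇔ (mk⇔ cancel mono) _ _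
  where
  cancel : toℕ (combine u v) < toℕ (combine u v′) → toℕ v < toℕ v′
  cancel lt rewrite toℕ-combine u v | toℕ-combine u v′ = +-cancelˡ-< (n * toℕ u) (toℕ v) (toℕ v′) lt
  mono : toℕ v < toℕ v′ → toℕ (combine u v) < toℕ (combine u v′)
  mono lt rewrite toℕ-combine u v | toℕ-combine u v′ = +-monoʳ-< (n * toℕ u) lt

Irreflexive : ∀ {n} → (Fin n → Fin n → Bool) → Set
Irreflexive keep = ∀ u → keep u u ≡ false

edgeTerm : ∀ {n} → (Fin n → Fin n → ℕ) → (Fin n → Fin n → Bool) → Fin n → Fin n → ℕ
edgeTerm m keep u u′ = if ⌊ u <? u′ ⌋ ∧ keep u u′ then m u u′ else 0

-- The filters defining adhLink and adhNode are irreflexive, and irreflexivity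
-- is what discards the edges of G′ inside a single fibre of f.
record MultipliesCountsBy (G′ G : Graph) (c : ℕ) (f : Fin (Graph.n G′) → Fin (Graph.n G)) : Set where
  field
    vertexSums : ∀ g → Σᶠ (g ∘ f) ≡ c * Σᶠ g
    edgeCounts : ∀ keep → Irreflexive keep →
      edgeCount (Graph.mult G′) (λ x y → keep (f x) (f y)) ≡ c * edgeCount (Graph.mult G) keep

pullback : {G′ G : Graph} → (Fin (Graph.n G′) → Fin (Graph.n G)) →
  TreeCutDecomposition G → TreeCutDecomposition G′
pullback f D = record { tree = TreeCutDecomposition.tree D ; bag = TreeCutDecomposition.bag D ∘ f }

module _ {G′ G : Graph} {c : ℕ} {f : Fin (Graph.n G′) → Fin (Graph.n G)}
         (scales : MultipliesCountsBy G′ G c f) (D : TreeCutDecomposition G) where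
  open MultipliesCountsBy scales
  open TreeCutDecomposition D
  open Tree tree using (link)

  D′ : TreeCutDecomposition G′
  D′ = pullback f D

  adhLink-pullback : ∀ a b → adhLink D′ a b ≡ c * adhLink D a b
  adhLink-pullback a b = edgeCounts _ (λ u → cong not (reach-refl (delLink link a b) (bag u)))

  adhNode-pullback : ∀ b → adhNode D′ b ≡ c * adhNode D b
  adhNode-pullback b = edgeCounts _ irreflexive
    where
    irreflexive : Irreflexive
      (λ u v → not ⌊ bag u ≟ᶠ b ⌋ ∧ not ⌊ bag v ≟ᶠ b ⌋ ∧ not (reach (delNode link b) (bag u) (bag v)))
    irreflexive u rewrite reach-refl (delNode link b) (bag u) | ∧-zeroʳ (not ⌊ bag u ≟ᶠ b ⌋) =
      ∧-zeroʳ (not ⌊ bag u ≟ᶠ b ⌋)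

  bagSize-pullback : ∀ b → bagSize D′ b ≡ c * bagSize D b
  bagSize-pullback b = vertexSums _

  pullback-width : ∀ w → WidthAtMost D w → WidthAtMost D′ (c * w)
  pullback-width w (adhLink≤ , node≤) =
    (λ a b l → subst (_≤ c * w) (sym (adhLink-pullback a b)) (*-monoʳ-≤ c (adhLink≤ a b l))) ,
    (λ b → subst (_≤ c * w) (sym (node-pullback b)) (*-monoʳ-≤ c (node≤ b)))
    where
    node-pullback : ∀ b → bagSize D′ b + adhNode D′ b ≡ c * (bagSize D b + adhNode D b)
    node-pullback b =
      trans (cong₂ _+_ (bagSize-pullback b) (adhNode-pullback b)) (sym (*-distribˡ-+ c _ _))

module Projections (G H : Graph) where
  open Graph G using () renaming (n to nG; mult to multG)
  open Graph H using () renaming (n to nH; mult to multH)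

  π₁ : Fin (nG * nH) → Fin nG
  π₁ = proj₁ ∘ remQuot {nG} nH

  π₂ : Fin (nG * nH) → Fin nH
  π₂ = proj₂ ∘ remQuot {nG} nH

  multᶜ : Fin nG → Fin nH → Fin nG → Fin nH → ℕ
  multᶜ u v u′ v′ = if ⌊ u ≟ᶠ u′ ⌋ then multH v v′ else (if ⌊ v ≟ᶠ v′ ⌋ then multG u u′ else 0)

  □-mult-combine : ∀ u v u′ v′ → Graph.mult (G □ H) (combine u v) (combine u′ v′) ≡ multᶜ u v u′ v′
  □-mult-combine u v u′ v′ =
    cong₂ (λ (p p′ : Fin nG × Fin nH) → multᶜ (proj₁ p) (proj₂ p) (proj₁ p′) (proj₂ p′))
      (remQuot-combine {nG} u v) (remQuot-combine {nG} u′ v′)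

  π₁-combine : ∀ u v → π₁ (combine u v) ≡ u
  π₁-combine u v = cong proj₁ (remQuot-combine {nG} u v)

  π₂-combine : ∀ u v → π₂ (combine u v) ≡ v
  π₂-combine u v = cong proj₂ (remQuot-combine {nG} u v)

  edgeTerm-π₁ : ∀ keep → Irreflexive keep → ∀ u v u′ v′ →
    edgeTerm (Graph.mult (G □ H)) (λ x y → keep (π₁ x) (π₁ y)) (combine u v) (combine u′ v′) ≡
    (if ⌊ v ≟ᶠ v′ ⌋ then edgeTerm multG keep u u′ else 0)
  edgeTerm-π₁ keep irr u v u′ v′ =
    trans (cong₂ (λ k m → if ⌊ combine u v <? combine u′ v′ ⌋ ∧ k then m else 0)
                 (cong₂ keep (π₁-combine u v) (π₁-combine u′ v′)) (□-mult-combine u v u′ v′))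
          (in-layers u v u′ v′)
    where
    in-layers : ∀ u v u′ v′ →
      (if ⌊ combine u v <? combine u′ v′ ⌋ ∧ keep u u′ then multᶜ u v u′ v′ else 0) ≡
      (if ⌊ v ≟ᶠ v′ ⌋ then edgeTerm multG keep u u′ else 0)
    in-layers u v u′ v′ with u ≟ᶠ u′ | v ≟ᶠ v′
    ... | yes refl | yes refl
      rewrite irr u | ∧-zeroʳ ⌊ combine {nG} u v <? combine u v ⌋ | ∧-zeroʳ ⌊ u <? u ⌋ = refl
    ... | yes refl | no _ rewrite irr u | ∧-zeroʳ ⌊ combine {nG} u v <? combine u v′ ⌋ = refl
    ... | no _ | yes refl rewrite combine-<-fst u u′ v = refl
    ... | no _ | no _ = if-eta _

  edgeTerm-π₂ : ∀ keep → Irreflexive keep → ∀ u v u′ v′ →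
    edgeTerm (Graph.mult (G □ H)) (λ x y → keep (π₂ x) (π₂ y)) (combine u v) (combine u′ v′) ≡
    (if ⌊ u ≟ᶠ u′ ⌋ then edgeTerm multH keep v v′ else 0)
  edgeTerm-π₂ keep irr u v u′ v′ =
    trans (cong₂ (λ k m → if ⌊ combine u v <? combine u′ v′ ⌋ ∧ k then m else 0)
                 (cong₂ keep (π₂-combine u v) (π₂-combine u′ v′)) (□-mult-combine u v u′ v′))
          (in-fibres u v u′ v′)
    where
    in-fibres : ∀ u v u′ v′ →
      (if ⌊ combine u v <? combine u′ v′ ⌋ ∧ keep v v′ then multᶜ u v u′ v′ else 0) ≡
      (if ⌊ u ≟ᶠ u′ ⌋ then edgeTerm multH keep v v′ else 0)
    in-fibres u v u′ v′ with u ≟ᶠ u′ | v ≟ᶠ v′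
    ... | yes refl | _ rewrite combine-<-snd u v v′ = refl
    ... | no _ | yes refl rewrite irr v | ∧-zeroʳ ⌊ combine {nG} u v <? combine u′ v ⌋ = refl
    ... | no _ | no _ = if-eta _

  π₁-multipliesCounts : MultipliesCountsBy (G □ H) G nH π₁
  π₁-multipliesCounts = record { vertexSums = vertexSums ; edgeCounts = edgeCounts }
    where
    vertexSums : ∀ g → Σᶠ (g ∘ π₁) ≡ nH * Σᶠ g
    vertexSums g = begin
      Σᶠ (g ∘ π₁)                                   ≡⟨ Σᶠ-combine nG nH _ ⟩
      Σᶠ {nG} (λ u → Σᶠ {nH} (λ v → g (π₁ (combine u v))))
        ≡⟨ sum-cong-≗ {nG} (λ u → sum-cong-≗ {nH} λ v → cong g (π₁-combine u v)) ⟩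
      Σᶠ {nG} (λ u → Σᶠ {nH} (λ _ → g u))          ≡⟨ sum-cong-≗ {nG} (λ u → Σᶠ-const {nH} (g u)) ⟩
      Σᶠ {nG} (λ u → nH * g u)                      ≡⟨ sym (*-distribˡ-sum nH g) ⟩
      nH * Σᶠ g                                     ∎

    edgeCounts : ∀ keep → Irreflexive keep →
      edgeCount (Graph.mult (G □ H)) (λ x y → keep (π₁ x) (π₁ y)) ≡ nH * edgeCount multG keep
    edgeCounts keep irr = begin
      edgeCount (Graph.mult (G □ H)) (λ x y → keep (π₁ x) (π₁ y))
        ≡⟨ Σᶠ²-combine nG nH (edgeTerm-π₁ keep irr) ⟩
      Σᶠ {nG} (λ u → Σᶠ {nH} (λ v → Σᶠ {nG} (λ u′ → Σᶠ {nH} (λ v′ →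
        if ⌊ v ≟ᶠ v′ ⌋ then edgeTerm multG keep u u′ else 0))))
        ≡⟨ sum-cong-≗ {nG} (λ u → sum-cong-≗ {nH} λ v → sum-cong-≗ {nG} λ u′ →
             Σᶠ-delta v (λ _ → edgeTerm multG keep u u′)) ⟩
      Σᶠ {nG} (λ u → Σᶠ {nH} (λ _ → Σᶠ (edgeTerm multG keep u)))
        ≡⟨ sum-cong-≗ {nG} (λ u → Σᶠ-const {nH} (Σᶠ (edgeTerm multG keep u))) ⟩
      Σᶠ {nG} (λ u → nH * Σᶠ (edgeTerm multG keep u))
        ≡⟨ sym (*-distribˡ-sum nH (Σᶠ ∘ edgeTerm multG keep)) ⟩
      nH * edgeCount multG keep ∎

  π₂-multipliesCounts : MultipliesCountsBy (G □ H) H nG π₂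
  π₂-multipliesCounts = record { vertexSums = vertexSums ; edgeCounts = edgeCounts }
    where
    vertexSums : ∀ g → Σᶠ (g ∘ π₂) ≡ nG * Σᶠ g
    vertexSums g = begin
      Σᶠ (g ∘ π₂)                                   ≡⟨ Σᶠ-combine nG nH _ ⟩
      Σᶠ {nG} (λ u → Σᶠ {nH} (λ v → g (π₂ (combine u v))))
        ≡⟨ sum-cong-≗ {nG} (λ u → sum-cong-≗ {nH} λ v → cong g (π₂-combine u v)) ⟩
      Σᶠ {nG} (λ _ → Σᶠ g)                          ≡⟨ Σᶠ-const {nG} (Σᶠ g) ⟩
      nG * Σᶠ g                                     ∎

    edgeCounts : ∀ keep → Irreflexive keep →
      edgeCount (Graph.mult (G □ H)) (λ x y → keep (π₂ x) (π₂ y)) ≡ nG * edgeCount multH keep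
    edgeCounts keep irr = begin
      edgeCount (Graph.mult (G □ H)) (λ x y → keep (π₂ x) (π₂ y))
        ≡⟨ Σᶠ²-combine nG nH (edgeTerm-π₂ keep irr) ⟩
      Σᶠ {nG} (λ u → Σᶠ {nH} (λ v → Σᶠ {nG} (λ u′ → Σᶠ {nH} (λ v′ →
        if ⌊ u ≟ᶠ u′ ⌋ then edgeTerm multH keep v v′ else 0))))
        ≡⟨ sum-cong-≗ {nG} (λ u → sum-cong-≗ {nH} λ v →
             trans (∑-comm {nG} {nH} _)
                   (sum-cong-≗ {nH} λ v′ → Σᶠ-delta u (λ _ → edgeTerm multH keep v v′))) ⟩
      Σᶠ {nG} (λ _ → edgeCount multH keep)
        ≡⟨ Σᶠ-const {nG} (edgeCount multH keep) ⟩
      nG * edgeCount multH keep ∎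

ScwAtMost-□ˡ : ∀ G H {w} → ScwAtMost G w → ScwAtMost (G □ H) (Graph.n H * w)
ScwAtMost-□ˡ G H {w} (D , D≤w) = pullback π₁ D , pullback-width π₁-multipliesCounts D w D≤w
  where open Projections G H

ScwAtMost-□ʳ : ∀ G H {w} → ScwAtMost H w → ScwAtMost (G □ H) (Graph.n G * w)
ScwAtMost-□ʳ G H {w} (D , D≤w) = pullback π₂ D , pullback-width π₂-multipliesCounts D w D≤w
  where open Projections G H

ScwAtMost-⊓ : ∀ G {a b} → ScwAtMost G a → ScwAtMost G b → ScwAtMost G (a ⊓ b)
ScwAtMost-⊓ G {a} {b} scw-a scw-b with ⊓-sel a b
... | inj₁ a⊓b≡a = subst (ScwAtMost G) (sym a⊓b≡a) scw-a
... | inj₂ a⊓b≡b = subst (ScwAtMost G) (sym a⊓b≡b) scw-b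

mainTheorem13 : (G H : Graph) → IsGraph G → IsGraph H →
    (w₁ w₂ : ℕ) → ScwAtMost G w₁ → ScwAtMost H w₂ →
    ScwAtMost (G □ H) ((Graph.n H * w₁) ⊓ (Graph.n G * w₂))
mainTheorem13 G H _ _ w₁ w₂ scw-G scw-H =
  ScwAtMost-⊓ (G □ H) (ScwAtMost-□ˡ G H scw-G) (ScwAtMost-□ʳ G H scw-H)
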